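{- For every integer $n\ge 0$, the list $\mathcal{D}_n$ defined below contains every $231$-avoiding permutation of $\{1,\ldots,n\}$ exactly once (and consists of $c_n$ entries).
   Context: A permutation $\pi=\pi_1\cdots\pi_n$ of $\{1,\ldots,n\}$ avoids $231$ if there are no indices $a<b<c$ with $\pi_c<\pi_a<\pi_b$. Let $c_n=\frac{1}{n+1}\binom{2n}{n}$ be the $n$-th Catalan number. Let $A(1)=0$ and $A(i)=c_0+c_1+\cdots+c_{i-2}$ for $i>1$. Lists of permutations are written as ordered sequences; the $j$-th entry of a list $\mathcal{D}_n$ is $\mathcal{D}_n(j)$. For a positive integer $i$, $\mathcal{D}_n^i$ denotes $\mathcal{D}_n$ if $i$ is odd and the reversal of $\mathcal{D}_n$ if $i$ is even, so $\mathcal{D}_n^i(j)=\mathcal{D}_n^{i+1}(c_n+1-j)$. For a permutation (word) $w$ and integer $l$, $w+l$ denotes $w$ with every entry increased by $l$. $[\alpha,n,\beta]$ denotes the word obtained by concatenating the word $\alpha$, the letter $n$, and the word $\beta$; concatenation with the empty permutation $\emptyset$ leaves a word unchanged. $\bigoplus$ denotes concatenation of lists in the order of the indices (outer index varying slowest). Define $\mathcal{D}_0=(\emptyset)$ and for $n\ge1$ $$\mathcal{D}_n=\bigoplus_{i=1}^{n}\bigoplus_{j=1}^{c_{i-1}}\bigoplus_{k=1}^{c_{n-i}}\left[\mathcal{D}_{i-1}^{\,n+i-1}(j),\ n,\ \mathcal{D}_{n-i}^{\,j+A(i)+1}(k)+(i-1)\right].$$ -}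

module Defs where

open import Data.Nat using (ℕ; zero; suc; _+_; _∸_; _<_)
open import Data.Nat.Combinatorics using (_C_)
open import Data.Nat.DivMod using (_/_)
open import Data.Bool using (Bool; true; false; not; if_then_else_)
open import Data.List using (List; []; _∷_; [_]; _++_; map; concatMap; reverse; upTo; length; lookup)
open import Data.Nat.ListAction using (sum)
open import Data.Fin using (Fin)
import Data.Fin as Fin
open import Data.Product using (_×_)
open import Relation.Nullary using (¬_)
open import Data.List.Relation.Binary.Permutation.Propositional using (_↭_)

catalan : ℕ → ℕ
catalan n = ((n + n) C n) / suc n

A : ℕ → ℕ
A i = sum (map catalan (upTo (i ∸ 1)))

range1 : ℕ → List ℕ
range1 m = map suc (upTo m)

isOdd : ℕ → Bool
isOdd zero = false
isOdd (suc n) = not (isOdd n)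

orient : {X : Set} → ℕ → List X → List X
orient i L = if isOdd i then L else reverse L

-- 0-based indexing with default value (the empty word) out of range
nth : List (List ℕ) → ℕ → List ℕ
nth [] _ = []
nth (x ∷ _) zero = x
nth (_ ∷ xs) (suc j) = nth xs j

shift : ℕ → List ℕ → List ℕ
shift l w = map (_+ l) w

D' : ℕ → ℕ → List (List ℕ)
D' _ zero = [ [] ]
D' zero (suc m) = []
D' (suc f) (suc m) =
  concatMap (λ i →
    concatMap (λ j →
      map (λ k →
        nth (orient (n + i ∸ 1) (D' f (i ∸ 1))) (j ∸ 1)
          ++ (n ∷ shift (i ∸ 1) (nth (orient (j + A i + 1) (D' f (n ∸ i))) (k ∸ 1))))
        (range1 (catalan (n ∸ i))))
      (range1 (catalan (i ∸ 1))))
    (range1 n)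
  where n = suc m

-- D_n (fuel n+1 is enough, since recursive calls are at strictly smaller n)
D : ℕ → List (List ℕ)
D n = D' (suc n) n

IsPerm : ℕ → List ℕ → Set
IsPerm n w = w ↭ range1 n

Avoids231 : List ℕ → Set
Avoids231 w = (a b c : Fin (length w)) → a Fin.< b → b Fin.< c →
  ¬ (lookup w c < lookup w a × lookup w a < lookup w b)

-- A 231-avoiding permutation of 1, …, m + 1 factors uniquely as [α, m + 1, β + a], where α is a
-- 231-avoiding permutation of 1, …, a and β one of 1, …, m − a: in a 231-avoiding word everything
-- before the maximum lies below everything after it. D_{m+1} runs through exactly these words, the
-- orientations only changing the order in which the α and the β are visited, so by induction it
-- lists each 231-avoiding permutation once and its length obeys c_{m+1} = Σ_a c_a c_{m−a}. That
-- recursion follows from c_n = C(2n, n)/(n + 1) through the coefficients of the powers of the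
-- Catalan series, which satisfy the ballot formula (2m + k) [xᵐ]Cᵏ = k C(2m + k, m).

module Submission where

open import Defs
open import Algebra.Properties.CommutativeSemigroup as CommSemigroupProperties using ()
open import Data.Bool using (true; false)
open import Data.Fin using (Fin; zero; suc)
import Data.Fin as Fin
open import Data.Nat using (ℕ; zero; suc; _+_; _*_; _∸_; _≤_; _<_; z≤n; s≤s; z<s; s<s)
open import Data.Nat.Properties
open import Data.Nat.Combinatorics using (_C_; k>n⇒nCk≡0; nCk+nC[k+1]≡[n+1]C[k+1])
open import Data.Nat.DivMod using (_/_; m*n/n≡m)
open import Data.Nat.ListAction using (sum)
open import Data.Nat.Tactic.RingSolver using (solve-∀)
open import Data.List using (List; []; _∷_; [_]; _++_; map; concat; concatMap; filter; upTo; applyUpTo; length; lookup)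
open import Data.List.Properties
  using (map-upTo; map-∘; map-injective; length-++; length-map; length-upTo; length-filter
        ; ∷-injectiveˡ; ∷-injectiveʳ; ++-cancelˡ)
open import Data.List.Relation.Unary.All as All using (All; []; _∷_)
import Data.List.Relation.Unary.All.Properties as All
open import Data.List.Relation.Unary.Any using (here; there)
import Data.List.Relation.Unary.AllPairs as AllPairs
open import Data.List.Relation.Unary.Unique.Propositional using (Unique; []; _∷_)
import Data.List.Relation.Unary.Unique.Propositional.Properties as Unique
open import Data.List.Membership.Propositional using (_∈_; _∉_; find; lose)
open import Data.List.Membership.Propositional.Properties
  using ( ∈-map⁺; ∈-map⁻; ∈-concatMap⁺; ∈-concatMap⁻; ∈-++⁺ˡ; ∈-++⁺ʳ; ∈-++⁻; ∈-∃++; ∈-upTo⁺; ∈-upTo⁻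
        ; ∈-filter⁺; ∈-filter⁻; ∈-lookup)
open import Data.List.Membership.Propositional.Properties.WithK using (unique∧set⇒bag)
open import Data.List.Membership.DecPropositional _≟_ using (_∈?_)
open import Data.List.Relation.Binary.BagAndSetEquality using (∼bag⇒↭)
open import Data.List.Relation.Binary.Permutation.Propositional as ↭
  using (_↭_; ↭-refl; ↭-reflexive; ↭-sym; ↭-trans; ↭⇒↭ₛ)
open import Data.List.Relation.Binary.Permutation.Propositional.Properties
  using (↭-length; ↭-reverse; map⁺; ++⁺; ++⁺ˡ; shifts; ∈-resp-↭; All-resp-↭) renaming (shift to ↭-shift)
import Data.List.Relation.Binary.Permutation.Setoid.Properties as PermutationSetoid
open import Data.Product using (_×_; _,_; proj₁; proj₂; uncurry; map₁; map₂; ∃; ∃₂)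
open import Data.Product.Function.NonDependent.Propositional using (_×-⇔_)
open import Data.Sum using (inj₁; inj₂)
open import Data.Unit using (⊤; tt)
open import Function using (_∘_; _⇔_; mk⇔; Equivalence)
open import Relation.Nullary using (¬_; contradiction; yes; no)
open import Relation.Binary.PropositionalEquality hiding ([_])
open ≡-Reasoning

-- Catalan numbers

binomial : ℕ → ℕ → ℕ
binomial n       zero    = 1
binomial zero    (suc k) = 0
binomial (suc n) (suc k) = binomial n k + binomial n (suc k)

binomial≡C : ∀ n k → binomial n k ≡ n C k
binomial≡C n       zero    = refl
binomial≡C zero    (suc k) = sym (k>n⇒nCk≡0 (s≤s (z≤n {k})))
binomial≡C (suc n) (suc k) =
  trans (cong₂ _+_ (binomial≡C n k) (binomial≡C n (suc k))) (nCk+nC[k+1]≡[n+1]C[k+1] n k)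

binomial-1 : ∀ n → binomial n 1 ≡ n
binomial-1 zero    = refl
binomial-1 (suc n) = cong suc (binomial-1 n)

binomial-absorption : ∀ n k → suc k * binomial (suc n) (suc k) ≡ suc n * binomial n k
binomial-absorption zero    zero    = refl
binomial-absorption zero    (suc k) = *-zeroʳ (suc (suc k))
binomial-absorption (suc n) zero    =
  trans (+-identityʳ _) (trans (cong suc (binomial-1 (suc n))) (sym (*-identityʳ _)))
binomial-absorption (suc n) (suc k) = begin
  suc (suc k) * (b k + b (suc k))
    ≡⟨ split (suc k) (b k) (b (suc k)) ⟩
  b k + (suc k * b k + suc (suc k) * b (suc k))
    ≡⟨ cong₂ (λ u v → b k + (u + v)) (binomial-absorption n k) (binomial-absorption n (suc k)) ⟩
  b k + (suc n * binomial n k + suc n * binomial n (suc k))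
    ≡⟨ merge (suc n) (binomial n k) (binomial n (suc k)) ⟩
  suc (suc n) * (binomial n k + binomial n (suc k))
    ∎
  where
  b : ℕ → ℕ
  b j = binomial (suc n) (suc j)
  split : ∀ a x y → suc a * (x + y) ≡ x + (a * x + suc a * y)
  split = solve-∀
  merge : ∀ a x y → (x + y) + (a * x + a * y) ≡ suc a * (x + y)
  merge = solve-∀

-- (k + 1) C(n, k + 1) = (n - k) C(n, k), with the subtraction moved to the other side.
binomial-ratio : ∀ n k → suc k * binomial n (suc k) + suc k * binomial n k ≡ suc n * binomial n k
binomial-ratio n k = begin
  suc k * binomial n (suc k) + suc k * binomial n k
    ≡⟨ +-comm (suc k * binomial n (suc k)) _ ⟩
  suc k * binomial n k + suc k * binomial n (suc k)
    ≡⟨ *-distribˡ-+ (suc k) (binomial n k) _ ⟨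
  suc k * binomial (suc n) (suc k)
    ≡⟨ binomial-absorption n k ⟩
  suc n * binomial n k
    ∎

-- The coefficient of xᵐ in Cᵏ for the Catalan series C = 1 + x C², via Cᵏ⁺¹ = Cᵏ + x Cᵏ⁺².
catalanPower : ℕ → ℕ → ℕ
catalanPower zero    zero    = 1
catalanPower zero    (suc m) = 0
catalanPower (suc k) zero    = 1
catalanPower (suc k) (suc m) = catalanPower k (suc m) + catalanPower (suc (suc k)) m

-- With M = 2m + k + 2, b = C(M, m) and b′ = C(M, m + 1), this is the inductive step of the
-- ballot formula below; it is checked after multiplying by M (m + 1).
ballot-step : ∀ m k x y b b′ →
  (suc m + suc m + k) * x ≡ k * b′ →
  (suc m + suc m + k) * y ≡ suc (suc k) * b →
  suc m * b′ + suc m * b ≡ suc (suc m + suc m + k) * b →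
  suc (suc m + suc m + k) * (x + y) ≡ suc k * (b + b′)
ballot-step m k x y b b′ hx hy hb =
  *-cancelˡ-≡ _ _ (suc m) (*-cancelˡ-≡ _ _ M (trans lhs (sym rhs)))
  where
  M = suc m + suc m + k
  hb′ : suc m * b′ ≡ suc (suc (m + k)) * b
  hb′ = +-cancelʳ-≡ (suc m * b) _ _ (trans hb (expand m k b))
    where
    expand : ∀ m k b → suc (suc m + suc m + k) * b ≡ suc (suc (m + k)) * b + suc m * b
    expand = solve-∀
  lhs : M * (suc m * (suc M * (x + y))) ≡ M * suc k * (suc m * b + suc (suc (m + k)) * b)
  lhs = begin
    M * (suc m * (suc M * (x + y)))
      ≡⟨ e₁ M (suc M) (suc m) x y ⟩
    suc M * (suc m * (M * x) + suc m * (M * y))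
      ≡⟨ cong₂ (λ u v → suc M * (suc m * u + suc m * v)) hx hy ⟩
    suc M * (suc m * (k * b′) + suc m * (suc (suc k) * b))
      ≡⟨ e₂ (suc M) (suc m) k b b′ ⟩
    suc M * (k * (suc m * b′) + suc m * suc (suc k) * b)
      ≡⟨ cong (λ u → suc M * (k * u + suc m * suc (suc k) * b)) hb′ ⟩
    suc M * (k * (suc (suc (m + k)) * b) + suc m * suc (suc k) * b)
      ≡⟨ e₃ m k b ⟩
    M * suc k * (suc m * b + suc (suc (m + k)) * b)
      ∎
    where
    e₁ : ∀ M sM c x y → M * (c * (sM * (x + y))) ≡ sM * (c * (M * x) + c * (M * y))
    e₁ = solve-∀
    e₂ : ∀ sM c k b b′ → sM * (c * (k * b′) + c * (suc (suc k) * b))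
                       ≡ sM * (k * (c * b′) + c * suc (suc k) * b)
    e₂ = solve-∀
    e₃ : ∀ m k b → suc (suc m + suc m + k) * (k * (suc (suc (m + k)) * b) + suc m * suc (suc k) * b)
                 ≡ (suc m + suc m + k) * suc k * (suc m * b + suc (suc (m + k)) * b)
    e₃ = solve-∀
  rhs : M * (suc m * (suc k * (b + b′))) ≡ M * suc k * (suc m * b + suc (suc (m + k)) * b)
  rhs = trans (e M (suc m) k b b′) (cong (λ u → M * suc k * (suc m * b + u)) hb′)
    where
    e : ∀ M c k b b′ → M * (c * (suc k * (b + b′))) ≡ M * suc k * (c * b + c * b′)
    e = solve-∀

catalanPower-ballot : ∀ k m → (m + m + k) * catalanPower k m ≡ k * binomial (m + m + k) m
catalanPower-ballot zero    zero    = refl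
catalanPower-ballot zero    (suc m) = *-zeroʳ (suc m + suc m + 0)
catalanPower-ballot (suc k) zero    = refl
catalanPower-ballot (suc k) (suc m) = begin
  (suc m + suc m + suc k) * (catalanPower k (suc m) + catalanPower (suc (suc k)) m)
    ≡⟨ cong (_* (catalanPower k (suc m) + catalanPower (suc (suc k)) m)) M+1 ⟩
  suc M * (catalanPower k (suc m) + catalanPower (suc (suc k)) m)
    ≡⟨ ballot-step m k _ _ _ _ (catalanPower-ballot k (suc m)) ih (binomial-ratio M m) ⟩
  suc k * binomial (suc M) (suc m)
    ≡⟨ cong (λ u → suc k * binomial u (suc m)) M+1 ⟨
  suc k * binomial (suc m + suc m + suc k) (suc m)
    ∎
  where
  M = suc m + suc m + k
  M+1 : suc m + suc m + suc k ≡ suc M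
  M+1 = e m k
    where
    e : ∀ m k → suc m + suc m + suc k ≡ suc (suc m + suc m + k)
    e = solve-∀
  ih : M * catalanPower (suc (suc k)) m ≡ suc (suc k) * binomial M m
  ih = subst (λ u → u * catalanPower (suc (suc k)) m ≡ suc (suc k) * binomial u m)
             (e m k) (catalanPower-ballot (suc (suc k)) m)
    where
    e : ∀ m k → m + m + suc (suc k) ≡ suc m + suc m + k
    e = solve-∀

catalanPower-1 : ∀ t → suc t * catalanPower 1 t ≡ binomial (t + t) t
catalanPower-1 t = *-cancelˡ-≡ _ _ (suc (t + t)) (begin
  suc (t + t) * (suc t * catalanPower 1 t)
    ≡⟨ x∙yz≈y∙xz (suc (t + t)) (suc t) (catalanPower 1 t) ⟩
  suc t * (suc (t + t) * catalanPower 1 t)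
    ≡⟨ cong (suc t *_) ballot ⟩
  suc t * binomial (suc (t + t)) t
    ≡⟨ symmetric ⟨
  suc t * (binomial (t + t) t + binomial (t + t) (suc t))
    ≡⟨ trans (*-distribˡ-+ (suc t) (binomial (t + t) t) _) (+-comm (suc t * binomial (t + t) t) _) ⟩
  suc t * binomial (t + t) (suc t) + suc t * binomial (t + t) t
    ≡⟨ binomial-ratio (t + t) t ⟩
  suc (t + t) * binomial (t + t) t
    ∎)
  where
  open CommSemigroupProperties *-commutativeSemigroup using (x∙yz≈y∙xz)
  ballot : suc (t + t) * catalanPower 1 t ≡ binomial (suc (t + t)) t
  ballot = subst (λ u → u * catalanPower 1 t ≡ binomial u t) (+-comm (t + t) 1)
                 (trans (catalanPower-ballot 1 t) (+-identityʳ _))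
  -- C(2t + 1, t + 1) = C(2t + 1, t), in the form given by binomial-ratio.
  symmetric : suc t * binomial (suc (t + t)) (suc t) ≡ suc t * binomial (suc (t + t)) t
  symmetric = +-cancelʳ-≡ (suc t * binomial (suc (t + t)) t) _ _ (begin
    suc t * binomial (suc (t + t)) (suc t) + suc t * binomial (suc (t + t)) t
      ≡⟨ binomial-ratio (suc (t + t)) t ⟩
    suc (suc (t + t)) * binomial (suc (t + t)) t
      ≡⟨ cong (_* binomial (suc (t + t)) t) (sym (+-suc (suc t) t)) ⟩
    (suc t + suc t) * binomial (suc (t + t)) t
      ≡⟨ *-distribʳ-+ (binomial (suc (t + t)) t) (suc t) (suc t) ⟩
    suc t * binomial (suc (t + t)) t + suc t * binomial (suc (t + t)) t
      ∎)

catalan≡catalanPower-1 : ∀ t → catalan t ≡ catalanPower 1 t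
catalan≡catalanPower-1 t = begin
  ((t + t) C t) / suc t                ≡⟨ cong (_/ suc t) (binomial≡C (t + t) t) ⟨
  binomial (t + t) t / suc t           ≡⟨ cong (_/ suc t) (catalanPower-1 t) ⟨
  (suc t * catalanPower 1 t) / suc t   ≡⟨ cong (_/ suc t) (*-comm (suc t) (catalanPower 1 t)) ⟩
  (catalanPower 1 t * suc t) / suc t   ≡⟨ m*n/n≡m (catalanPower 1 t) (suc t) ⟩
  catalanPower 1 t                     ∎

sum-applyUpTo-cong : ∀ {f g : ℕ → ℕ} n → (∀ {i} → i < n → f i ≡ g i) →
  sum (applyUpTo f n) ≡ sum (applyUpTo g n)
sum-applyUpTo-cong zero    _   = refl
sum-applyUpTo-cong (suc n) f≗g = cong₂ _+_ (f≗g z<s) (sum-applyUpTo-cong n (f≗g ∘ s<s))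

sum-applyUpTo-+ : ∀ (f g : ℕ → ℕ) n →
  sum (applyUpTo (λ i → f i + g i) n) ≡ sum (applyUpTo f n) + sum (applyUpTo g n)
sum-applyUpTo-+ f g zero    = refl
sum-applyUpTo-+ f g (suc n) =
  trans (cong (f 0 + g 0 +_) (sum-applyUpTo-+ (f ∘ suc) (g ∘ suc) n)) (interchange (f 0) (g 0) _ _)
  where open CommSemigroupProperties +-commutativeSemigroup using (interchange)

catalanPower-0 : ∀ k → catalanPower k 0 ≡ 1
catalanPower-0 zero    = refl
catalanPower-0 (suc k) = refl

catalanPower-suc : ∀ m k →
  sum (applyUpTo (λ i → catalanPower k i * catalanPower 1 (m ∸ i)) (suc m)) ≡ catalanPower (suc k) m
catalanPower-suc zero k = trans (+-identityʳ _) (trans (*-identityʳ _) (catalanPower-0 k))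
catalanPower-suc (suc m) zero = begin
  1 * catalanPower 1 (suc m) + sum (applyUpTo (λ i → 0 * catalanPower 1 (m ∸ i)) (suc m))
    ≡⟨ cong (1 * catalanPower 1 (suc m) +_)
            (sum-applyUpTo-cong {f = λ i → 0 * catalanPower 1 (m ∸ i)} (suc m) (λ _ → refl)) ⟩
  1 * catalanPower 1 (suc m) + sum (applyUpTo (λ _ → 0) (suc m))
    ≡⟨ cong₂ _+_ (*-identityˡ _) (sum-applyUpTo-0 (suc m)) ⟩
  catalanPower 1 (suc m) + 0
    ≡⟨ +-identityʳ _ ⟩
  catalanPower 1 (suc m)
    ∎
  where
  sum-applyUpTo-0 : ∀ n → sum (applyUpTo (λ _ → 0) n) ≡ 0
  sum-applyUpTo-0 zero    = refl
  sum-applyUpTo-0 (suc n) = sum-applyUpTo-0 n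
catalanPower-suc (suc m) (suc k) = begin
  1 * c (suc m) + sum (applyUpTo (λ i → (p k (suc i) + p (suc (suc k)) i) * c (m ∸ i)) (suc m))
    ≡⟨ cong (1 * c (suc m) +_) (trans
         (sum-applyUpTo-cong (suc m) (λ {i} _ → *-distribʳ-+ (c (m ∸ i)) (p k (suc i)) (p (suc (suc k)) i)))
         (sum-applyUpTo-+ (λ i → p k (suc i) * c (m ∸ i)) (λ i → p (suc (suc k)) i * c (m ∸ i)) (suc m))) ⟩
  1 * c (suc m) + (sum (applyUpTo (λ i → p k (suc i) * c (m ∸ i)) (suc m))
                   + sum (applyUpTo (λ i → p (suc (suc k)) i * c (m ∸ i)) (suc m)))
    ≡⟨ +-assoc (1 * c (suc m)) _ _ ⟨
  (1 * c (suc m) + sum (applyUpTo (λ i → p k (suc i) * c (m ∸ i)) (suc m)))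
    + sum (applyUpTo (λ i → p (suc (suc k)) i * c (m ∸ i)) (suc m))
    ≡⟨ cong (λ u → (u * c (suc m) + sum (applyUpTo (λ i → p k (suc i) * c (m ∸ i)) (suc m)))
                   + sum (applyUpTo (λ i → p (suc (suc k)) i * c (m ∸ i)) (suc m)))
            (sym (catalanPower-0 k)) ⟩
  sum (applyUpTo (λ i → p k i * c (suc m ∸ i)) (suc (suc m)))
    + sum (applyUpTo (λ i → p (suc (suc k)) i * c (m ∸ i)) (suc m))
    ≡⟨ cong₂ _+_ (catalanPower-suc (suc m) k) (catalanPower-suc m (suc (suc k))) ⟩
  p (suc (suc k)) (suc m)
    ∎
  where
  p = catalanPower
  c = catalanPower 1

catalan-suc : ∀ m → catalan (suc m) ≡ sum (applyUpTo (λ a → catalan a * catalan (m ∸ a)) (suc m))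
catalan-suc m = begin
  catalan (suc m)
    ≡⟨ catalan≡catalanPower-1 (suc m) ⟩
  catalanPower 2 m
    ≡⟨ catalanPower-suc m 1 ⟨
  sum (applyUpTo (λ a → catalanPower 1 a * catalanPower 1 (m ∸ a)) (suc m))
    ≡⟨ sum-applyUpTo-cong (suc m)
         (λ {a} _ → cong₂ _*_ (catalan≡catalanPower-1 a) (catalan≡catalanPower-1 (m ∸ a))) ⟨
  sum (applyUpTo (λ a → catalan a * catalan (m ∸ a)) (suc m))
    ∎

-- Lists and permutations

Unique-resp-↭ : {A : Set} {xs ys : List A} → xs ↭ ys → Unique xs → Unique ys
Unique-resp-↭ p = PermutationSetoid.Unique-resp-↭ (setoid _) (↭⇒↭ₛ p)

↭-unique-sets : {A : Set} {xs ys : List A} → Unique xs → Unique ys →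
  (∀ {z} → z ∈ xs → z ∈ ys) → (∀ {z} → z ∈ ys → z ∈ xs) → xs ↭ ys
↭-unique-sets uxs uys xs⊆ys ys⊆xs = ∼bag⇒↭ (unique∧set⇒bag uxs uys (mk⇔ xs⊆ys ys⊆xs))

length-mono-⊆ : {xs ys : List ℕ} → Unique xs → Unique ys → (∀ {z} → z ∈ xs → z ∈ ys) →
  length xs ≤ length ys
length-mono-⊆ {xs} {ys} uxs uys xs⊆ys =
  ≤-trans (≤-reflexive (↭-length xs↭ys∩xs)) (length-filter (_∈? xs) ys)
  where
  xs↭ys∩xs : xs ↭ filter (_∈? xs) ys
  xs↭ys∩xs = ↭-unique-sets uxs (Unique.filter⁺ (_∈? xs) {ys} uys)
    (λ z∈xs → ∈-filter⁺ (_∈? xs) (xs⊆ys z∈xs) z∈xs)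
    (λ z∈ys∩xs → proj₂ (∈-filter⁻ (_∈? xs) {xs = ys} z∈ys∩xs))

Unique-concatMap⁺ : {A B : Set} {f : A → List B} {xs : List A} → Unique xs →
  (∀ {x} → x ∈ xs → Unique (f x)) →
  (∀ {x y z} → x ∈ xs → y ∈ xs → z ∈ f x → z ∈ f y → x ≡ y) →
  Unique (concatMap f xs)
Unique-concatMap⁺ {xs = []}     _            _       _        = []
Unique-concatMap⁺ {f = f} {xs = x ∷ xs} (x∉xs ∷ uxs) uf disjoint =
  Unique.++⁺ (uf (here refl)) (Unique-concatMap⁺ uxs (uf ∘ there) (λ p q → disjoint (there p) (there q)))
    λ (z∈fx , z∈rest) → let (y , y∈xs , z∈fy) = find (∈-concatMap⁻ f z∈rest) in
      All.All¬⇒¬Any x∉xs (subst (_∈ xs) (sym (disjoint (here refl) (there y∈xs) z∈fx z∈fy)) y∈xs)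

Unique-++⁻ : {A : Set} (u : List A) {v : List A} → Unique (u ++ v) →
  Unique u × Unique v × (∀ {x} → x ∈ u → x ∉ v)
Unique-++⁻ []      uv             = [] , uv , λ ()
Unique-++⁻ (y ∷ u) (y∉uv ∷ uv) with Unique-++⁻ u uv
... | uu , uv′ , disjoint =
  All.++⁻ˡ u y∉uv ∷ uu , uv′ ,
  λ { (here refl) x∈v → All.lookup y∉uv (∈-++⁺ʳ u x∈v) refl ; (there x∈u) → disjoint x∈u }

++-∷-cancel : {A : Set} {n : A} (α α′ : List A) {γ γ′ : List A} → n ∉ α → n ∉ α′ →
  α ++ n ∷ γ ≡ α′ ++ n ∷ γ′ → α ≡ α′ × γ ≡ γ′
++-∷-cancel []      []       _   _    eq = refl , ∷-injectiveʳ eq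
++-∷-cancel []      (_ ∷ _)  _   n∉α′ eq = contradiction (here (∷-injectiveˡ eq)) n∉α′
++-∷-cancel (_ ∷ _) []       n∉α _    eq = contradiction (here (sym (∷-injectiveˡ eq))) n∉α
++-∷-cancel (x ∷ α) (_ ∷ α′) n∉α n∉α′ eq with refl ← ∷-injectiveˡ eq =
  map₁ (cong (x ∷_)) (++-∷-cancel α α′ (n∉α ∘ there) (n∉α′ ∘ there) (∷-injectiveʳ eq))

concat⁺ : {A : Set} {xss yss : List (List A)} → xss ↭ yss → concat xss ↭ concat yss
concat⁺ ↭.refl           = ↭-refl
concat⁺ (↭.prep xs p)    = ++⁺ˡ xs (concat⁺ p)
concat⁺ (↭.swap xs ys p) = ↭-trans (shifts xs ys) (++⁺ˡ ys (++⁺ˡ xs (concat⁺ p)))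
concat⁺ (↭.trans p q)    = ↭-trans (concat⁺ p) (concat⁺ q)

concatMap-cong-↭ : {A B : Set} {f g : A → List B} (xs : List A) →
  (∀ {x} → x ∈ xs → f x ↭ g x) → concatMap f xs ↭ concatMap g xs
concatMap-cong-↭ []       _   = ↭-refl
concatMap-cong-↭ (x ∷ xs) f↭g = ++⁺ (f↭g (here refl)) (concatMap-cong-↭ xs (f↭g ∘ there))

length-concatMap : {A B : Set} (f : A → List B) (xs : List A) →
  length (concatMap f xs) ≡ sum (map (length ∘ f) xs)
length-concatMap f []       = refl
length-concatMap f (x ∷ xs) = trans (length-++ (f x)) (cong (length (f x) +_) (length-concatMap f xs))

length-concatMap-const : {A B : Set} (f : A → List B) (xs : List A) {c : ℕ} →
  (∀ x → length (f x) ≡ c) → length (concatMap f xs) ≡ length xs * c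
length-concatMap-const f []       _     = refl
length-concatMap-const f (x ∷ xs) |f|≡c =
  trans (length-++ (f x)) (cong₂ _+_ (|f|≡c x) (length-concatMap-const f xs |f|≡c))

applyUpTo-nth : {B : Set} (f : List ℕ → B) (L : List (List ℕ)) →
  applyUpTo (λ k → f (nth L k)) (length L) ≡ map f L
applyUpTo-nth f []      = refl
applyUpTo-nth f (x ∷ L) = cong (f x ∷_) (applyUpTo-nth f L)

concat-applyUpTo-nth-↭ : {B : Set} (h : ℕ → List ℕ → List B) (g : List ℕ → List B) (L : List (List ℕ)) →
  (∀ k x → h k x ↭ g x) → concat (applyUpTo (λ k → h k (nth L k)) (length L)) ↭ concatMap g L
concat-applyUpTo-nth-↭ h g []      _   = ↭-refl
concat-applyUpTo-nth-↭ h g (x ∷ L) h↭g =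
  ++⁺ (h↭g 0 x) (concat-applyUpTo-nth-↭ (h ∘ suc) g L (h↭g ∘ suc))

orient-↭ : {X : Set} (i : ℕ) (L : List X) → orient i L ↭ L
orient-↭ i L with isOdd i
... | true  = ↭-refl
... | false = ↭-reverse L

map-range1 : {B : Set} (f : ℕ → B) (n : ℕ) → map f (range1 n) ≡ applyUpTo (f ∘ suc) n
map-range1 f n = trans (sym (map-∘ (upTo n))) (map-upTo (f ∘ suc) n)

∈-range1⁻ : ∀ {n z} → z ∈ range1 n → 1 ≤ z × z ≤ n
∈-range1⁻ z∈ with _ , y∈ , refl ← ∈-map⁻ suc z∈ = s≤s z≤n , ∈-upTo⁻ y∈

∈-range1⁺ : ∀ {n z} → 1 ≤ z → z ≤ n → z ∈ range1 n
∈-range1⁺ {z = suc z} _ z<n = ∈-map⁺ suc (∈-upTo⁺ z<n)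

Unique-range1 : ∀ n → Unique (range1 n)
Unique-range1 n = Unique.map⁺ suc-injective (Unique.upTo⁺ n)

length-range1 : ∀ n → length (range1 n) ≡ n
length-range1 n = trans (length-map suc (upTo n)) (length-upTo n)

map-range1-nth : {B : Set} (f : List ℕ → B) (L : List (List ℕ)) {c : ℕ} → c ≡ length L →
  map (λ k → f (nth L (k ∸ 1))) (range1 c) ≡ map f L
map-range1-nth f L refl = trans (map-range1 (λ k → f (nth L (k ∸ 1))) (length L)) (applyUpTo-nth f L)

concatMap-range1-nth-↭ : {B : Set} (h : ℕ → List ℕ → List B) (g : List ℕ → List B)
  (L : List (List ℕ)) {c : ℕ} → c ≡ length L → (∀ k x → h k x ↭ g x) → concatMap (λ k → h k (nth L (k ∸ 1))) (range1 c) ↭ concatMap g L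
concatMap-range1-nth-↭ h g L refl h↭g = ↭-trans
  (↭-reflexive (cong concat (map-range1 (λ k → h k (nth L (k ∸ 1))) (length L))))
  (concat-applyUpTo-nth-↭ (h ∘ suc) g L (h↭g ∘ suc))

record PermOf (n : ℕ) (w : List ℕ) : Set where
  field
    unique   : Unique w
    bounded  : ∀ {z} → z ∈ w → 1 ≤ z × z ≤ n
    complete : ∀ {z} → 1 ≤ z → z ≤ n → z ∈ w

open PermOf

IsPerm⇒PermOf : ∀ {n w} → IsPerm n w → PermOf n w
IsPerm⇒PermOf {n} w↭ = record
  { unique   = Unique-resp-↭ (↭-sym w↭) (Unique-range1 n)
  ; bounded  = λ z∈w → ∈-range1⁻ (∈-resp-↭ w↭ z∈w)
  ; complete = λ 1≤z z≤bound → ∈-resp-↭ (↭-sym w↭) (∈-range1⁺ 1≤z z≤bound)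
  }

PermOf⇒IsPerm : ∀ {n w} → PermOf n w → IsPerm n w
PermOf⇒IsPerm {n} π = ↭-unique-sets (unique π) (Unique-range1 n)
  (λ z∈w → uncurry ∈-range1⁺ (bounded π z∈w)) (λ z∈r → uncurry (complete π) (∈-range1⁻ z∈r))

PermOf-length : ∀ {n w} → PermOf n w → length w ≡ n
PermOf-length {n} π = trans (↭-length (PermOf⇒IsPerm π)) (length-range1 n)

-- 231-avoidance

-- No231At x v: no 231 pattern of x ∷ v has x as its 2.
No231At : ℕ → List ℕ → Set
No231At x []      = ⊤
No231At x (y ∷ v) = (x < y → All (x ≤_) v) × No231At x v

Avoid231 : List ℕ → Set
Avoid231 []      = ⊤
Avoid231 (x ∷ v) = No231At x v × Avoid231 v

All-lookup : ∀ {P : ℕ → Set} {v : List ℕ} → All P v → (i : Fin (length v)) → P (lookup v i)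
All-lookup pv i = All.lookup pv (∈-lookup i)

All-tabulate-lookup : ∀ {P : ℕ → Set} (v : List ℕ) → ((i : Fin (length v)) → P (lookup v i)) → All P v
All-tabulate-lookup []      _ = []
All-tabulate-lookup (y ∷ v) p = p zero ∷ All-tabulate-lookup v (p ∘ suc)

No231Lookup : ℕ → List ℕ → Set
No231Lookup x v = (b c : Fin (length v)) → b Fin.< c → ¬ (lookup v c < x × x < lookup v b)

No231At⇒No231Lookup : ∀ x v → No231At x v → No231Lookup x v
No231At⇒No231Lookup x (y ∷ v) (after , _)  zero    (suc c) _         (vc<x , x<y) =
  <⇒≱ vc<x (All-lookup (after x<y) c)
No231At⇒No231Lookup x (y ∷ v) (_ , noPat) (suc b) (suc c) (s≤s b<c) vc<x<vb   =
  No231At⇒No231Lookup x v noPat b c b<c vc<x<vb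

No231Lookup⇒No231At : ∀ x v → No231Lookup x v → No231At x v
No231Lookup⇒No231At x []      _     = tt
No231Lookup⇒No231At x (y ∷ v) noPat =
  (λ x<y → All-tabulate-lookup v (λ c → ≮⇒≥ (λ vc<x → noPat zero (suc c) (s≤s z≤n) (vc<x , x<y))))
  , No231Lookup⇒No231At x v (λ b c b<c → noPat (suc b) (suc c) (s≤s b<c))

Avoid231⇒Avoids231 : ∀ w → Avoid231 w → Avoids231 w
Avoid231⇒Avoids231 (x ∷ w) (noPat , _)   zero    (suc b) (suc c) _         (s≤s b<c) =
  No231At⇒No231Lookup x w noPat b c b<c
Avoid231⇒Avoids231 (x ∷ w) (_ , avoid) (suc a) (suc b) (suc c) (s≤s a<b) (s≤s b<c) =
  Avoid231⇒Avoids231 w avoid a b c a<b b<c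

Avoids231⇒Avoid231 : ∀ w → Avoids231 w → Avoid231 w
Avoids231⇒Avoid231 []      _     = tt
Avoids231⇒Avoid231 (x ∷ w) avoid =
  No231Lookup⇒No231At x w (λ b c b<c → avoid zero (suc b) (suc c) (s≤s z≤n) (s≤s b<c))
  , Avoids231⇒Avoid231 w (λ a b c a<b b<c → avoid (suc a) (suc b) (suc c) (s≤s a<b) (s≤s b<c))

No231At-≤ : ∀ {x} v → All (x ≤_) v → No231At x v
No231At-≤ []      _          = tt
No231At-≤ (y ∷ v) (_ ∷ x≤v) = (λ _ → x≤v) , No231At-≤ v x≤v

No231At-> : ∀ {x} v → All (_< x) v → No231At x v
No231At-> []      _            = tt
No231At-> (y ∷ v) (y<x ∷ v<x) = (λ x<y → contradiction y<x (<-asym x<y)) , No231At-> v v<x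

No231At-++⁺ : ∀ {x} u {v} → No231At x u → All (x ≤_) v → No231At x (u ++ v)
No231At-++⁺ []      _              x≤v = No231At-≤ _ x≤v
No231At-++⁺ (y ∷ u) (after , noPat) x≤v =
  (λ x<y → All.++⁺ (after x<y) x≤v) , No231At-++⁺ u noPat x≤v

No231At-++⁻ˡ : ∀ {x} u {v} → No231At x (u ++ v) → No231At x u
No231At-++⁻ˡ []      _               = tt
No231At-++⁻ˡ (y ∷ u) (after , noPat) = (λ x<y → All.++⁻ˡ u (after x<y)) , No231At-++⁻ˡ u noPat

Avoid231-++⁺ : ∀ u {v} → Avoid231 u → Avoid231 v → All (λ x → All (x ≤_) v) u → Avoid231 (u ++ v)
Avoid231-++⁺ []      _                avoidᵥ _            = avoidᵥ
Avoid231-++⁺ (x ∷ u) (noPat , avoidᵤ) avoidᵥ (x≤v ∷ u≤v) =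
  No231At-++⁺ u noPat x≤v , Avoid231-++⁺ u avoidᵤ avoidᵥ u≤v

Avoid231-++⁻ˡ : ∀ u {v} → Avoid231 (u ++ v) → Avoid231 u
Avoid231-++⁻ˡ []      _               = tt
Avoid231-++⁻ˡ (x ∷ u) (noPat , avoid) = No231At-++⁻ˡ u noPat , Avoid231-++⁻ˡ u avoid

Avoid231-++⁻ʳ : ∀ u {v} → Avoid231 (u ++ v) → Avoid231 v
Avoid231-++⁻ʳ []      avoid     = avoid
Avoid231-++⁻ʳ (x ∷ u) (_ , avoid) = Avoid231-++⁻ʳ u avoid

Avoid231-split : ∀ {n} u {γ} → Avoid231 (u ++ n ∷ γ) → All (_< n) u → All (λ x → All (x ≤_) γ) u
Avoid231-split []      _               []           = []
Avoid231-split {n} (x ∷ u) {γ} (noPat , avoid) (x<n ∷ u<n) = below u noPat ∷ Avoid231-split u avoid u<n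
  where
  below : ∀ u → No231At x (u ++ n ∷ γ) → All (x ≤_) γ
  below []      (after , _) = after x<n
  below (_ ∷ u) (_ , noPat) = below u noPat

No231At-shift : ∀ {x} a v → No231At (x + a) (shift a v) ⇔ No231At x v
No231At-shift a []      = mk⇔ (λ _ → tt) (λ _ → tt)
No231At-shift {x} a (y ∷ v) = mk⇔ to from ×-⇔ No231At-shift a v
  where
  All≤-shift : All (x + a ≤_) (shift a v) ⇔ All (x ≤_) v
  All≤-shift = mk⇔ (All.map (λ {y} → +-cancelʳ-≤ a x y) ∘ All.map⁻) (All.map⁺ ∘ All.map (+-monoˡ-≤ a))
  to : (x + a < y + a → All (x + a ≤_) (shift a v)) → x < y → All (x ≤_) v
  to after x<y = Equivalence.to All≤-shift (after (+-monoˡ-< a x<y))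
  from : (x < y → All (x ≤_) v) → x + a < y + a → All (x + a ≤_) (shift a v)
  from after x+a<y+a = Equivalence.from All≤-shift (after (+-cancelʳ-< a x y x+a<y+a))

Avoid231-shift : ∀ a v → Avoid231 (shift a v) ⇔ Avoid231 v
Avoid231-shift a []      = mk⇔ (λ _ → tt) (λ _ → tt)
Avoid231-shift a (x ∷ v) = No231At-shift a v ×-⇔ Avoid231-shift a v

-- Decomposition at the maximum

PermOf-delete : ∀ {m} α {γ} → PermOf (suc m) (α ++ suc m ∷ γ) → PermOf m (α ++ γ)
PermOf-delete {m} α {γ} π = record
  { unique   = uαγ
  ; bounded  = λ z∈ → proj₁ (bounded π (toWhole z∈)) ,
                      ≤-pred (≤∧≢⇒< (proj₂ (bounded π (toWhole z∈))) λ { refl → n∉αγ z∈ })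
  ; complete = λ 1≤z z≤m → fromWhole (complete π 1≤z (m≤n⇒m≤1+n z≤m)) (λ { refl → 1+n≰n z≤m })
  }
  where
  moveMax : α ++ suc m ∷ γ ↭ suc m ∷ α ++ γ
  moveMax = ↭-shift (suc m) α γ
  uniqueMoved : Unique (suc m ∷ α ++ γ)
  uniqueMoved = Unique-resp-↭ moveMax (unique π)
  n∉αγ : suc m ∉ α ++ γ
  n∉αγ = Unique.Unique[x∷xs]⇒x∉xs uniqueMoved
  uαγ : Unique (α ++ γ)
  uαγ = AllPairs.tail uniqueMoved
  toWhole : ∀ {z} → z ∈ α ++ γ → z ∈ α ++ suc m ∷ γ
  toWhole = ∈-resp-↭ (↭-sym moveMax) ∘ there
  fromWhole : ∀ {z} → z ∈ α ++ suc m ∷ γ → z ≢ suc m → z ∈ α ++ γ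
  fromWhole z∈ z≢n with ∈-resp-↭ moveMax z∈
  ... | here z≡n = contradiction z≡n z≢n
  ... | there z∈αγ = z∈αγ

PermOf-prefix-≤ : ∀ {m} α {γ} → PermOf m (α ++ γ) → length α ≤ m
PermOf-prefix-≤ α {γ} π =
  subst (length α ≤_) (trans (sym (length-++ α)) (PermOf-length π)) (m≤m+n (length α) (length γ))

PermOf-lower : ∀ {m} α {γ} → PermOf m (α ++ γ) → (∀ {x z} → x ∈ α → z ∈ γ → x < z) →
  PermOf (length α) α
PermOf-lower {m} α {γ} π α<γ = record
  { unique   = uα
  ; bounded  = λ z∈α → proj₁ (bounded π (∈-++⁺ˡ z∈α)) , z≤length z∈α
  ; complete = complete′
  }
  where
  uα : Unique α
  uα = proj₁ (Unique-++⁻ α (unique π))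
  a≤m : length α ≤ m
  a≤m = PermOf-prefix-≤ α π
  -- None of 1, …, z can lie in γ, so they all lie in α.
  z≤length : ∀ {z} → z ∈ α → z ≤ length α
  z≤length {z} z∈α = subst (_≤ length α) (length-range1 z) (length-mono-⊆ (Unique-range1 z) uα sub)
    where
    sub : ∀ {y} → y ∈ range1 z → y ∈ α
    sub y∈ with (1≤y , y≤z) ← ∈-range1⁻ y∈
      with ∈-++⁻ α (complete π 1≤y (≤-trans y≤z (proj₂ (bounded π (∈-++⁺ˡ z∈α)))))
    ... | inj₁ y∈α = y∈α
    ... | inj₂ y∈γ = contradiction y≤z (<⇒≱ (α<γ z∈α y∈γ))
  complete′ : ∀ {z} → 1 ≤ z → z ≤ length α → z ∈ α
  complete′ {suc z} 1≤z z≤a with ∈-++⁻ α (complete π 1≤z (≤-trans z≤a a≤m))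
  ... | inj₁ z∈α = z∈α
  ... | inj₂ z∈γ = contradiction (≤-trans z≤a a≤z) 1+n≰n
    where
    a≤z : length α ≤ z
    a≤z = subst (length α ≤_) (length-range1 z) (length-mono-⊆ uα (Unique-range1 z)
      (λ x∈α → ∈-range1⁺ (proj₁ (bounded π (∈-++⁺ˡ x∈α))) (≤-pred (α<γ x∈α z∈γ))))

shift-unshift : ∀ a γ → All (a <_) γ → shift a (map (_∸ a) γ) ≡ γ
shift-unshift a []      []            = refl
shift-unshift a (z ∷ γ) (a<z ∷ a<γ) = cong₂ _∷_ (m∸n+n≡m (<⇒≤ a<z)) (shift-unshift a γ a<γ)

PermOf-upper : ∀ {m} α γ → PermOf m (α ++ γ) → PermOf (length α) α →
  PermOf (m ∸ length α) (map (_∸ length α) γ) × shift (length α) (map (_∸ length α) γ) ≡ γ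
PermOf-upper {m} α γ π πα = record { unique = uβ ; bounded = boundedβ ; complete = completeβ } , γ≡
  where
  a = length α
  β = map (_∸ a) γ
  disjoint : ∀ {x} → x ∈ α → x ∉ γ
  disjoint = proj₂ (proj₂ (Unique-++⁻ α (unique π)))
  inγ : ∀ {z} → z ∈ γ → z ∈ α ++ γ
  inγ = ∈-++⁺ʳ α
  a<γ : ∀ {z} → z ∈ γ → a < z
  a<γ z∈γ = ≰⇒> λ z≤a → disjoint (complete πα (proj₁ (bounded π (inγ z∈γ))) z≤a) z∈γ
  γ≡ : shift a β ≡ γ
  γ≡ = shift-unshift a γ (All.tabulate a<γ)
  uβ : Unique β
  uβ = Unique.map⁻ (subst Unique (sym γ≡) (proj₁ (proj₂ (Unique-++⁻ α (unique π)))))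
  shifted∈γ : ∀ {y} → y ∈ β → y + a ∈ γ
  shifted∈γ {y} y∈β = subst (y + a ∈_) γ≡ (∈-map⁺ (_+ a) y∈β)
  boundedβ : ∀ {y} → y ∈ β → 1 ≤ y × y ≤ m ∸ a
  boundedβ {y} y∈β = positive y (a<γ (shifted∈γ y∈β)) ,
    subst (_≤ m ∸ a) (m+n∸n≡m y a) (∸-monoˡ-≤ a (proj₂ (bounded π (inγ (shifted∈γ y∈β)))))
    where
    positive : ∀ y → a < y + a → 1 ≤ y
    positive zero    a<a = contradiction a<a (<-irrefl refl)
    positive (suc _) _   = s≤s z≤n
  completeβ : ∀ {y} → 1 ≤ y → y ≤ m ∸ a → y ∈ β
  completeβ {y} 1≤y y≤m-a
    with ∈-++⁻ α (complete π (≤-trans 1≤y (m≤m+n y a))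
                             (≤-trans (+-monoˡ-≤ a y≤m-a) (≤-reflexive (m∸n+n≡m (PermOf-prefix-≤ α π)))))
  ... | inj₁ y+a∈α =
    contradiction (proj₂ (bounded πα y+a∈α)) (<⇒≱ (subst (a <_) (+-comm a y) (m<m+n a 1≤y)))
  ... | inj₂ y+a∈γ
    with y′ , y′∈β , y+a≡y′+a ← ∈-map⁻ (_+ a) (subst (y + a ∈_) (sym γ≡) y+a∈γ) =
    subst (_∈ β) (sym (+-cancelʳ-≡ a y y′ y+a≡y′+a)) y′∈β

splice : ℕ → ℕ → List ℕ → List ℕ → List ℕ
splice m a α β = α ++ suc m ∷ shift a β

Perm231 : ℕ → List ℕ → Set
Perm231 n w = PermOf n w × Avoid231 w

∈-shift-PermOf : ∀ {k a β z} → PermOf k β → z ∈ shift a β → a < z × z ≤ k + a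
∈-shift-PermOf {k} {a} πβ z∈ with y , y∈β , refl ← ∈-map⁻ (_+ a) z∈ =
  +-monoˡ-≤ a (proj₁ (bounded πβ y∈β)) , +-monoˡ-≤ a (proj₂ (bounded πβ y∈β))

PermOf-splice : ∀ {m a α β} → a ≤ m → PermOf a α → PermOf (m ∸ a) β → PermOf (suc m) (splice m a α β)
PermOf-splice {m} {a} {α} {β} a≤m πα πβ = record
  { unique   = Unique.++⁺ (unique πα)
                 (All.¬Any⇒All¬ _ (λ n∈ → 1+n≰n (upper≤m n∈))
                   ∷ Unique.map⁺ (+-cancelʳ-≡ a _ _) (unique πβ))
                 λ { (x∈α , here refl) → 1+n≰n (≤-trans (proj₂ (bounded πα x∈α)) a≤m)
                   ; (x∈α , there x∈) → <-irrefl refl (lower<upper x∈α x∈) }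
  ; bounded  = bounded′
  ; complete = complete′
  }
  where
  upper≤m : ∀ {z} → z ∈ shift a β → z ≤ m
  upper≤m z∈ = ≤-trans (proj₂ (∈-shift-PermOf πβ z∈)) (≤-reflexive (m∸n+n≡m a≤m))
  lower<upper : ∀ {x z} → x ∈ α → z ∈ shift a β → x < z
  lower<upper x∈α z∈ = ≤-<-trans (proj₂ (bounded πα x∈α)) (proj₁ (∈-shift-PermOf πβ z∈))
  bounded′ : ∀ {z} → z ∈ splice m a α β → 1 ≤ z × z ≤ suc m
  bounded′ z∈ with ∈-++⁻ α z∈
  ... | inj₁ z∈α         = proj₁ (bounded πα z∈α) , m≤n⇒m≤1+n (≤-trans (proj₂ (bounded πα z∈α)) a≤m)
  ... | inj₂ (here refl) = s≤s z≤n , ≤-refl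
  ... | inj₂ (there z∈)  = ≤-<-trans z≤n (proj₁ (∈-shift-PermOf πβ z∈)) , m≤n⇒m≤1+n (upper≤m z∈)
  complete′ : ∀ {z} → 1 ≤ z → z ≤ suc m → z ∈ splice m a α β
  complete′ {z} 1≤z z≤1+m with z ≤? a
  ... | yes z≤a = ∈-++⁺ˡ (complete πα 1≤z z≤a)
  ... | no z≰a with z ≟ suc m
  ...   | yes z≡n = ∈-++⁺ʳ α (here z≡n)
  ...   | no z≢n  =
    ∈-++⁺ʳ α (there (subst (_∈ shift a β) (m∸n+n≡m (<⇒≤ a<z)) (∈-map⁺ (_+ a) z-a∈β)))
    where
    a<z : a < z
    a<z = ≰⇒> z≰a
    z-a∈β : z ∸ a ∈ β
    z-a∈β = complete πβ (m<n⇒0<n∸m a<z) (∸-monoˡ-≤ a (≤-pred (≤∧≢⇒< z≤1+m z≢n)))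

Avoid231-splice : ∀ {m a α β} → a ≤ m → PermOf a α → PermOf (m ∸ a) β → Avoid231 α → Avoid231 β →
  Avoid231 (splice m a α β)
Avoid231-splice {m} {a} {α} {β} a≤m πα πβ avα avβ =
  Avoid231-++⁺ α avα
    (No231At-> _ (All.tabulate λ z∈ → s≤s (≤-trans (proj₂ (∈-shift-PermOf πβ z∈)) (≤-reflexive (m∸n+n≡m a≤m))))
     , Equivalence.from (Avoid231-shift a β) avβ)
    (All.tabulate λ x∈α → m≤n⇒m≤1+n (≤-trans (x≤a x∈α) a≤m)
                        ∷ All.tabulate λ z∈ → <⇒≤ (≤-<-trans (x≤a x∈α) (proj₁ (∈-shift-PermOf πβ z∈))))
  where
  x≤a : ∀ {x} → x ∈ α → x ≤ a
  x≤a = proj₂ ∘ bounded πα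

Perm231-splice⁺ : ∀ {m a α β} → a ≤ m → Perm231 a α → Perm231 (m ∸ a) β →
  Perm231 (suc m) (splice m a α β)
Perm231-splice⁺ a≤m (πα , avα) (πβ , avβ) =
  PermOf-splice a≤m πα πβ , Avoid231-splice a≤m πα πβ avα avβ

Perm231-splice⁻ : ∀ {m w} → Perm231 (suc m) w →
  ∃ λ a → ∃₂ λ α β → a ≤ m × Perm231 a α × Perm231 (m ∸ a) β × w ≡ splice m a α β
Perm231-splice⁻ {m} (π , avw) with α , γ , refl ← ∈-∃++ (complete π (s≤s z≤n) ≤-refl) =
  length α , α , β , PermOf-prefix-≤ α πrest , (πα , Avoid231-++⁻ˡ α avw) , (πβ , avβ) ,
  cong (λ δ → α ++ suc m ∷ δ) (sym γ≡)
  where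
  πrest : PermOf m (α ++ γ)
  πrest = PermOf-delete α π
  n∉α : suc m ∉ α
  n∉α n∈α = proj₂ (proj₂ (Unique-++⁻ α (unique π))) n∈α (here refl)
  α<n : ∀ {x} → x ∈ α → x < suc m
  α<n x∈α = ≤∧≢⇒< (proj₂ (bounded π (∈-++⁺ˡ x∈α))) λ { refl → n∉α x∈α }
  α<γ : ∀ {x z} → x ∈ α → z ∈ γ → x < z
  α<γ x∈α z∈γ = ≤∧≢⇒< (All.lookup (All.lookup (Avoid231-split α avw (All.tabulate α<n)) x∈α) z∈γ)
                      λ { refl → proj₂ (proj₂ (Unique-++⁻ α (unique πrest))) x∈α z∈γ }
  πα : PermOf (length α) α
  πα = PermOf-lower α πrest α<γ
  β = map (_∸ length α) γ
  πβ : PermOf (m ∸ length α) β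
  πβ = proj₁ (PermOf-upper α γ πrest πα)
  γ≡ : shift (length α) β ≡ γ
  γ≡ = proj₂ (PermOf-upper α γ πrest πα)
  avβ : Avoid231 β
  avβ = Equivalence.to (Avoid231-shift (length α) β) (subst Avoid231 (sym γ≡) (proj₂ (Avoid231-++⁻ʳ α avw)))

-- The list D_n

Enumerates : {A : Set} → (A → Set) → List A → Set
Enumerates P L = Unique L × All P L × (∀ x → P x → x ∈ L)

Enumerates-resp-↭ : {A : Set} {P : A → Set} {L L′ : List A} → L ↭ L′ → Enumerates P L → Enumerates P L′
Enumerates-resp-↭ L↭L′ (uL , sound , complete) =
  Unique-resp-↭ L↭L′ uL , All-resp-↭ L↭L′ sound , λ x px → ∈-resp-↭ L↭L′ (complete x px)

splicesAt : ℕ → (ℕ → List (List ℕ)) → ℕ → List (List ℕ)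
splicesAt m L a = concatMap (λ α → map (splice m a α) (L (m ∸ a))) (L a)

splices : ℕ → (ℕ → List (List ℕ)) → List (List ℕ)
splices m L = concatMap (splicesAt m L) (upTo (suc m))

∈-splicesAt⁻ : ∀ {m L a w} → w ∈ splicesAt m L a →
  ∃₂ λ α β → α ∈ L a × β ∈ L (m ∸ a) × w ≡ splice m a α β
∈-splicesAt⁻ {m} {L} {a} w∈
  with α , α∈ , w∈′ ← find (∈-concatMap⁻ (λ α → map (splice m a α) (L (m ∸ a))) {L a} w∈)
  with β , β∈ , refl ← ∈-map⁻ (splice m a α) w∈′ = α , β , α∈ , β∈ , refl

∈-splices⁻ : ∀ {m L w} → w ∈ splices m L →
  ∃ λ a → ∃₂ λ α β → a ≤ m × α ∈ L a × β ∈ L (m ∸ a) × w ≡ splice m a α β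
∈-splices⁻ {m} {L} w∈ with a , a∈ , w∈′ ← find (∈-concatMap⁻ (splicesAt m L) {upTo (suc m)} w∈) =
  a , map₂ (map₂ (≤-pred (∈-upTo⁻ a∈) ,_)) (∈-splicesAt⁻ {m} {L} {a} w∈′)

∈-splices⁺ : ∀ {m L a α β} → a ≤ m → α ∈ L a → β ∈ L (m ∸ a) → splice m a α β ∈ splices m L
∈-splices⁺ {m} {L} {a} {α} a≤m α∈ β∈ =
  ∈-concatMap⁺ (splicesAt m L) (lose (∈-upTo⁺ (s≤s a≤m))
    (∈-concatMap⁺ (λ α → map (splice m a α) (L (m ∸ a))) (lose α∈ (∈-map⁺ (splice m a α) β∈))))

Unique-splices : ∀ {m L} → (∀ {a} → a ≤ m → All (Perm231 a) (L a) × Unique (L a)) →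
  Unique (splices m L)
Unique-splices {m} {L} enum = Unique-concatMap⁺ (Unique.upTo⁺ (suc m)) uniqueAt sameOffset
  where
  perm : ∀ {a α} → a ≤ m → α ∈ L a → PermOf a α
  perm a≤m α∈ = proj₁ (All.lookup (proj₁ (enum a≤m)) α∈)
  n∉ : ∀ {a α} → a ≤ m → α ∈ L a → suc m ∉ α
  n∉ a≤m α∈ n∈α = 1+n≰n (≤-trans (proj₂ (bounded (perm a≤m α∈) n∈α)) a≤m)
  uniqueAt : ∀ {a} → a ∈ upTo (suc m) → Unique (splicesAt m L a)
  uniqueAt {a} a∈ = Unique-concatMap⁺ (proj₂ (enum a≤m))
    (λ _ → Unique.map⁺ (λ eq → map-injective (+-cancelʳ-≡ a _ _) (∷-injectiveʳ (++-cancelˡ _ _ _ eq)))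
                       (proj₂ (enum (m∸n≤m m a))))
    λ α∈ α′∈ w∈ w∈′ →
      let (_ , _ , w≡) = ∈-map⁻ _ w∈ ; (_ , _ , w≡′) = ∈-map⁻ _ w∈′ in
      proj₁ (++-∷-cancel _ _ (n∉ a≤m α∈) (n∉ a≤m α′∈) (trans (sym w≡) w≡′))
    where
    a≤m : a ≤ m
    a≤m = ≤-pred (∈-upTo⁻ a∈)
  sameOffset : ∀ {a a′ w} → a ∈ upTo (suc m) → a′ ∈ upTo (suc m) →
    w ∈ splicesAt m L a → w ∈ splicesAt m L a′ → a ≡ a′
  sameOffset {a} {a′} a∈ a′∈ w∈ w∈′
    with α , _ , α∈ , _ , w≡ ← ∈-splicesAt⁻ {m} {L} {a} w∈
       | α′ , _ , α′∈ , _ , w≡′ ← ∈-splicesAt⁻ {m} {L} {a′} w∈′ = begin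
    a         ≡⟨ PermOf-length (perm a≤m α∈) ⟨
    length α  ≡⟨ cong length (proj₁ (++-∷-cancel α α′ (n∉ a≤m α∈) (n∉ a′≤m α′∈) (trans (sym w≡) w≡′)))
               ⟩
    length α′ ≡⟨ PermOf-length (perm a′≤m α′∈) ⟩
    a′        ∎
    where
    a≤m : a ≤ m
    a≤m = ≤-pred (∈-upTo⁻ a∈)
    a′≤m : a′ ≤ m
    a′≤m = ≤-pred (∈-upTo⁻ a′∈)

Enumerates-splices : ∀ {m L} → (∀ {a} → a ≤ m → Enumerates (Perm231 a) (L a)) →
  Enumerates (Perm231 (suc m)) (splices m L)
Enumerates-splices {m} {L} enum =
  Unique-splices (λ a≤m → proj₁ (proj₂ (enum a≤m)) , proj₁ (enum a≤m)) ,
  All.tabulate sound ,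
  complete′
  where
  sound : ∀ {w} → w ∈ splices m L → Perm231 (suc m) w
  sound w∈ with a , α , β , a≤m , α∈ , β∈ , refl ← ∈-splices⁻ {m} {L} w∈ =
    Perm231-splice⁺ a≤m (All.lookup (proj₁ (proj₂ (enum a≤m))) α∈)
                        (All.lookup (proj₁ (proj₂ (enum (m∸n≤m m a)))) β∈)
  complete′ : ∀ w → Perm231 (suc m) w → w ∈ splices m L
  complete′ w p with a , α , β , a≤m , pα , pβ , refl ← Perm231-splice⁻ {m} p =
    ∈-splices⁺ {m} {L} a≤m (proj₂ (proj₂ (enum a≤m)) α pα) (proj₂ (proj₂ (enum (m∸n≤m m a))) β pβ)

length-splices : ∀ m L → length (splices m L) ≡ sum (applyUpTo (λ a → length (L a) * length (L (m ∸ a))) (suc m))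
length-splices m L = begin
  length (splices m L)
    ≡⟨ length-concatMap (splicesAt m L) (upTo (suc m)) ⟩
  sum (map (length ∘ splicesAt m L) (upTo (suc m)))
    ≡⟨ cong sum (map-upTo (length ∘ splicesAt m L) (suc m)) ⟩
  sum (applyUpTo (length ∘ splicesAt m L) (suc m))
    ≡⟨ sum-applyUpTo-cong (suc m) (λ {a} _ → length-concatMap-const (λ α → map (splice m a α) (L (m ∸ a))) (L a)
                                                (λ α → length-map (splice m a α) (L (m ∸ a)))) ⟩
  sum (applyUpTo (λ a → length (L a) * length (L (m ∸ a))) (suc m))
    ∎

-- Orientations only reorder the lists D_k.
D'-suc-↭ : ∀ f m → (∀ {a} → a ≤ m → length (D' f a) ≡ catalan a) → D' (suc f) (suc m) ↭ splices m (D' f)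
D'-suc-↭ f m |D'| = ↭-trans (↭-reflexive (cong concat (sym (map-∘ (upTo (suc m))))))
  (concatMap-cong-↭ (upTo (suc m)) (λ a∈ → atOffset (≤-pred (∈-upTo⁻ a∈))))
  where
  n = suc m
  length-orient : ∀ {a} o → a ≤ m → catalan a ≡ length (orient o (D' f a))
  length-orient {a} o a≤m = sym (trans (↭-length (orient-↭ o (D' f a))) (|D'| a≤m))
  atOffset : ∀ {a} → a ≤ m →
    concatMap (λ j → map (λ k → nth (orient (n + suc a ∸ 1) (D' f a)) (j ∸ 1)
                               ++ n ∷ shift a (nth (orient (j + A (suc a) + 1) (D' f (m ∸ a))) (k ∸ 1)))
                         (range1 (catalan (m ∸ a))))
              (range1 (catalan a))
      ↭ splicesAt m (D' f) a
  atOffset {a} a≤m = ↭-trans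
    (concatMap-range1-nth-↭ h g (orient (n + suc a ∸ 1) (D' f a)) (length-orient (n + suc a ∸ 1) a≤m) h↭g)
    (concat⁺ (map⁺ g (orient-↭ (n + suc a ∸ 1) (D' f a))))
    where
    g : List ℕ → List (List ℕ)
    g α = map (splice m a α) (D' f (m ∸ a))
    h : ℕ → List ℕ → List (List ℕ)
    h j α = map (λ k → α ++ n ∷ shift a (nth (orient (j + A (suc a) + 1) (D' f (m ∸ a))) (k ∸ 1)))
                (range1 (catalan (m ∸ a)))
    h↭g : ∀ j α → h j α ↭ g α
    h↭g j α = ↭-trans
      (↭-reflexive (map-range1-nth (splice m a α) (orient (j + A (suc a) + 1) (D' f (m ∸ a)))
                                   (length-orient (j + A (suc a) + 1) (m∸n≤m m a))))
      (map⁺ (splice m a α) (orient-↭ (j + A (suc a) + 1) (D' f (m ∸ a))))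

Enumerates231 : ℕ → List (List ℕ) → Set
Enumerates231 n L = Enumerates (Perm231 n) L × length L ≡ catalan n

Enumerates231-splices : ∀ m L → (∀ {a} → a ≤ m → Enumerates231 a (L a)) → Enumerates231 (suc m) (splices m L)
Enumerates231-splices m L enum = Enumerates-splices (proj₁ ∘ enum) , (begin
  length (splices m L)
    ≡⟨ length-splices m L ⟩
  sum (applyUpTo (λ a → length (L a) * length (L (m ∸ a))) (suc m))
    ≡⟨ sum-applyUpTo-cong (suc m)
         (λ {a} a<n → cong₂ _*_ (proj₂ (enum (≤-pred a<n))) (proj₂ (enum (m∸n≤m m a)))) ⟩
  sum (applyUpTo (λ a → catalan a * catalan (m ∸ a)) (suc m))
    ≡⟨ catalan-suc m ⟨
  catalan (suc m)
    ∎)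

Enumerates231-[[]] : Enumerates231 0 [ [] ]
Enumerates231-[[]] = (([] ∷ []) , ((empty , tt) ∷ []) , complete′) , refl
  where
  empty : PermOf 0 []
  empty = record
    { unique = [] ; bounded = λ () ; complete = λ 1≤z z≤0 → contradiction (≤-trans 1≤z z≤0) λ () }
  complete′ : ∀ w → Perm231 0 w → w ∈ [ [] ]
  complete′ []      _       = here refl
  complete′ (_ ∷ _) (π , _) = contradiction (PermOf-length π) λ ()

Enumerates231-D' : ∀ f n → n < f → Enumerates231 n (D' f n)
Enumerates231-D' (suc f) zero    _         = Enumerates231-[[]]
Enumerates231-D' (suc f) (suc m) (s≤s m<f) =
  Enumerates-resp-↭ (↭-sym D↭) (proj₁ spliced) , trans (↭-length D↭) (proj₂ spliced)
  where
  enum : ∀ {a} → a ≤ m → Enumerates231 a (D' f a)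
  enum a≤m = Enumerates231-D' f _ (≤-<-trans a≤m m<f)
  D↭ : D' (suc f) (suc m) ↭ splices m (D' f)
  D↭ = D'-suc-↭ f m (proj₂ ∘ enum)
  spliced : Enumerates231 (suc m) (splices m (D' f))
  spliced = Enumerates231-splices m (D' f) enum

lemma2p1 : (n : ℕ) →
    length (D n) ≡ catalan n
    × Unique (D n)
    × All (λ w → IsPerm n w × Avoids231 w) (D n)
    × ((w : List ℕ) → IsPerm n w → Avoids231 w → w ∈ D n)
lemma2p1 n with (uD , sound , complete′) , |D| ← Enumerates231-D' (suc n) n ≤-refl =
  |D| , uD ,
  All.map (λ (π , av) → PermOf⇒IsPerm π , Avoid231⇒Avoids231 _ av) sound ,
  λ w w↭ av → complete′ w (IsPerm⇒PermOf w↭ , Avoids231⇒Avoid231 w av)
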